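{- For $n\ge1$, let $\varepsilon(n)$ be the number of $S$-nodes in a pairwise-summation SD-tree with $n$ leaf nodes. Then $$\varepsilon(n)=\sum_{i=0}^{\lfloor\log_2 n\rfloor}\left[\left(\left(\left\lfloor\frac{n}{2^i}\right\rfloor+1\right)\bmod 2\right)\cdot 2^i+(-1)^{\left(\left\lfloor\frac{n}{2^i}\right\rfloor+1\right)\bmod 2}\cdot\left(n\bmod 2^i\right)\right].$$
   Context: A summation tree is a rooted full binary tree (every node has $0$ or $2$ children). An SD-tree is a summation tree in which each internal node is labelled $S$ ($S$-node) if its two children have the same number of descendant leaves, and $D$ otherwise. A pairwise-summation tree is a summation tree in which every internal node having $k$ descendant leaves has two children having $\lfloor k/2\rfloor$ and $\lceil k/2\rceil$ descendant leaves respectively. All pairwise-summation trees with $n$ leaves are isomorphic (equal up to swapping children of nodes), so $\varepsilon(n)$ is well defined. -}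

module Defs where

open import Data.Nat as ℕ using (ℕ; zero; suc; ⌊_/2⌋; ⌈_/2⌉)
open import Data.Nat.DivMod using (_/_; _%_)
open import Data.Nat.Properties using (m^n≢0)
open import Data.Nat.Logarithm using (⌊log₂_⌋)
open import Data.Integer as ℤ using (ℤ; +_)
open import Data.Product using (_×_)
open import Data.Sum using (_⊎_)
open import Relation.Binary.PropositionalEquality using (_≡_)
open import Relation.Nullary.Decidable using (does)
open import Data.Bool using (if_then_else_)

data Tree : Set where
  leaf : Tree
  node : Tree → Tree → Tree

leaves : Tree → ℕ
leaves leaf       = 1
leaves (node l r) = leaves l ℕ.+ leaves r

sNodes : Tree → ℕ
sNodes leaf       = 0
sNodes (node l r) =
  (if does (leaves l ℕ.≟ leaves r) then 1 else 0) ℕ.+ (sNodes l ℕ.+ sNodes r)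

data Pairwise : Tree → Set where
  leaf : Pairwise leaf
  node : ∀ {l r} → Pairwise l → Pairwise r →
         ((leaves l ≡ ⌊ leaves (node l r) /2⌋ × leaves r ≡ ⌈ leaves (node l r) /2⌉)
          ⊎ (leaves l ≡ ⌈ leaves (node l r) /2⌉ × leaves r ≡ ⌊ leaves (node l r) /2⌋)) →
         Pairwise (node l r)

sumTo : ℕ → (ℕ → ℤ) → ℤ
sumTo zero    f = f 0
sumTo (suc m) f = sumTo m f ℤ.+ f (suc m)

term : ℕ → ℕ → ℤ
term n i =
  let instance _ = m^n≢0 2 i
      b = (n / (2 ℕ.^ i) ℕ.+ 1) % 2 in
  (+ b) ℤ.* (+ (2 ℕ.^ i)) ℤ.+ (ℤ.-1ℤ ℤ.^ b) ℤ.* (+ (n % (2 ℕ.^ i)))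

formula : ℕ → ℤ
formula n = sumTo ⌊log₂ n ⌋ (term n)

-- Both sides satisfy f 1 = 0, f (2m) = 1 + 2 f m and f (2m+1) = f m + f (m+1).
-- For ε this is the shape of a pairwise-summation tree: the root splits n into
-- ⌊n/2⌋ and ⌈n/2⌉ leaves and is an S-node exactly when n is even.  For the formula,
-- the i-th summand is the triangle wave |2^i − (n mod 2^(i+1))|, which is
-- piecewise linear with slopes ±1 and kinks at multiples of 2^i; rescaling by 2
-- gives the two recurrences summand by summand, and the summand i = 0 is the
-- parity of n + 1.  The range ⌊log₂ n⌋ grows by one from m to 2m and 2m+1; from m
-- to m+1 it grows only when m+1 = 2^k, where the new summand vanishes.

module Submission where

open import Defs
open import Data.Nat using (ℕ; _≥_)
open import Data.Integer using (+_)
open import Relation.Binary.PropositionalEquality using (_≡_)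

open import Data.Bool using (if_then_else_)
open import Data.Integer as ℤ using (ℤ)
import Data.Integer.Properties as ℤ
open import Algebra.Properties.CommutativeSemigroup ℤ.+-commutativeSemigroup using (interchange)
open import Data.Nat as ℕ
  using (zero; suc; _+_; _*_; _∸_; _^_; _<_; _≤_; z≤n; s≤s; NonZero; ⌊_/2⌋; ⌈_/2⌉; _≟_)
open import Data.Nat.Properties
open import Data.Nat.DivMod
open import Data.Nat.Divisibility using (n∣m*n)
open import Data.Nat.Induction using (<-wellFounded)
open import Data.Nat.Logarithm
open import Data.Nat.Logarithm.Core using (⌊log2⌋)
open import Data.Nat.Tactic.RingSolver using (solve-∀)
open import Data.Product using (_×_; _,_)
open import Data.Sum using (_⊎_; inj₁; inj₂)
open import Function using (_∘_)
open import Induction.WellFounded using (Acc; acc)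
open import Relation.Binary.PropositionalEquality
  using (refl; sym; trans; cong; cong₂; subst; module ≡-Reasoning)
open import Relation.Nullary.Decidable using (does; dec-true; dec-false)

2*m≡m+m : ∀ m → 2 * m ≡ m + m
2*m≡m+m = solve-∀

1+2*m≡m+[1+m] : ∀ m → suc (2 * m) ≡ m + suc m
1+2*m≡m+[1+m] = solve-∀

[m+n]∸[o+p]≡[m∸o]+[n∸p] : ∀ {m n o p} → o ≤ m → p ≤ n → (m + n) ∸ (o + p) ≡ (m ∸ o) + (n ∸ p)
[m+n]∸[o+p]≡[m∸o]+[n∸p] {m} z≤n     p≤n = +-∸-assoc m p≤n
[m+n]∸[o+p]≡[m∸o]+[n∸p]     (s≤s o≤m) p≤n = [m+n]∸[o+p]≡[m∸o]+[n∸p] o≤m p≤n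

n≡2*⌊n/2⌋⊎n≡1+2*⌊n/2⌋ : ∀ n → n ≡ 2 * ⌊ n /2⌋ ⊎ n ≡ suc (2 * ⌊ n /2⌋)
n≡2*⌊n/2⌋⊎n≡1+2*⌊n/2⌋ zero          = inj₁ refl
n≡2*⌊n/2⌋⊎n≡1+2*⌊n/2⌋ (suc zero)    = inj₂ refl
n≡2*⌊n/2⌋⊎n≡1+2*⌊n/2⌋ (suc (suc n)) with n≡2*⌊n/2⌋⊎n≡1+2*⌊n/2⌋ n
... | inj₁ n≡2h = inj₁ (trans (cong (λ x → suc (suc x)) n≡2h) (sym (*-suc 2 ⌊ n /2⌋)))
... | inj₂ n≡1+2h = inj₂ (trans (cong (λ x → suc (suc x)) n≡1+2h) (cong suc (sym (*-suc 2 ⌊ n /2⌋))))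

2*⌊n/2⌋≤n : ∀ n → 2 * ⌊ n /2⌋ ≤ n
2*⌊n/2⌋≤n n with n≡2*⌊n/2⌋⊎n≡1+2*⌊n/2⌋ n
... | inj₁ n≡2h   = ≤-reflexive (sym n≡2h)
... | inj₂ n≡1+2h = subst (2 * ⌊ n /2⌋ ≤_) (sym n≡1+2h) (n≤1+n _)

n≤1+2*⌊n/2⌋ : ∀ n → n ≤ suc (2 * ⌊ n /2⌋)
n≤1+2*⌊n/2⌋ n with n≡2*⌊n/2⌋⊎n≡1+2*⌊n/2⌋ n
... | inj₁ n≡2h   = subst (_≤ suc (2 * ⌊ n /2⌋)) (sym n≡2h) (n≤1+n _)
... | inj₂ n≡1+2h = ≤-reflexive n≡1+2h

2^⌊log2⌋n≤n : ∀ n .{{_ : NonZero n}} (rec : Acc _<_ n) → 2 ^ ⌊log2⌋ n rec ≤ n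
2^⌊log2⌋n≤n 1             _        = ≤-refl
2^⌊log2⌋n≤n (suc (suc n)) (acc rs) = begin
  2 * 2 ^ ⌊log2⌋ (suc h) _ ≤⟨ *-monoʳ-≤ 2 (2^⌊log2⌋n≤n (suc h) (rs (⌊n/2⌋<n (suc n)))) ⟩
  2 * suc h                ≡⟨ *-suc 2 h ⟩
  2 + 2 * h                ≤⟨ +-monoʳ-≤ 2 (2*⌊n/2⌋≤n n) ⟩
  2 + n                    ∎
  where
  open ≤-Reasoning
  h = ⌊ n /2⌋

n<2^[1+⌊log2⌋n] : ∀ n (rec : Acc _<_ n) → n < 2 ^ suc (⌊log2⌋ n rec)
n<2^[1+⌊log2⌋n] 0             _        = s≤s z≤n
n<2^[1+⌊log2⌋n] 1             _        = s≤s (s≤s z≤n)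
n<2^[1+⌊log2⌋n] (suc (suc n)) (acc rs) = begin-strict
  2 + n                          ≤⟨ +-monoʳ-≤ 2 (n≤1+2*⌊n/2⌋ n) ⟩
  3 + 2 * h                      <⟨ n<1+n _ ⟩
  4 + 2 * h                      ≡⟨ cong (λ x → 2 + x) (sym (*-suc 2 h)) ⟩
  2 + 2 * suc h                  ≡⟨ sym (*-suc 2 (suc h)) ⟩
  2 * suc (suc h)                ≤⟨ *-monoʳ-≤ 2 (n<2^[1+⌊log2⌋n] (suc h) (rs (⌊n/2⌋<n (suc n)))) ⟩
  2 * 2 ^ suc (⌊log2⌋ (suc h) _) ∎
  where
  open ≤-Reasoning
  h = ⌊ n /2⌋

⌊log₂⌋-jump : ∀ n .{{_ : NonZero n}} → ⌊log₂ n ⌋ < ⌊log₂ suc n ⌋ → suc n ≡ 2 ^ ⌊log₂ suc n ⌋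
⌊log₂⌋-jump n jump = ≤-antisym
  (≤-trans (n<2^[1+⌊log2⌋n] n (<-wellFounded n)) (^-monoʳ-≤ 2 jump))
  (2^⌊log2⌋n≤n (suc n) (<-wellFounded (suc n)))

⌊log₂[1+2*n]⌋≡1+⌊log₂n⌋ : ∀ n .{{_ : NonZero n}} → ⌊log₂ suc (2 * n) ⌋ ≡ 1 + ⌊log₂ n ⌋
⌊log₂[1+2*n]⌋≡1+⌊log₂n⌋ n = begin
  ⌊log₂ suc (2 * n) ⌋             ≡⟨ sym (m+[n∸m]≡n 1≤log) ⟩
  1 + (⌊log₂ suc (2 * n) ⌋ ∸ 1)   ≡⟨ cong suc (sym (⌊log₂⌊n/2⌋⌋≡⌊log₂n⌋∸1 (suc (2 * n)))) ⟩
  1 + ⌊log₂ ⌊ suc (2 * n) /2⌋ ⌋   ≡⟨ cong (λ x → 1 + ⌊log₂ x ⌋) ⌊1+2*n/2⌋≡n ⟩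
  1 + ⌊log₂ n ⌋                   ∎
  where
  open ≡-Reasoning
  1≤log : 1 ≤ ⌊log₂ suc (2 * n) ⌋
  1≤log = ⌊log₂⌋-mono-≤ {2} (s≤s (≤-trans (ℕ.>-nonZero⁻¹ n) (m≤m+n n _)))
  ⌊1+2*n/2⌋≡n : ⌊ suc (2 * n) /2⌋ ≡ n
  ⌊1+2*n/2⌋≡n = trans (cong (λ x → ⌈ n + x /2⌉) (+-identityʳ n)) (sym (n≡⌈n+n/2⌉ n))

-- tri q d r is the triangle wave x ↦ |d − (x mod 2d)| at x = q * d + r, for r ≤ d.
tri : (q d r : ℕ) → ℕ
tri zero          d r = d ∸ r
tri (suc zero)    d r = r
tri (suc (suc q)) d r = tri q d r

triangle : (d : ℕ) .{{_ : NonZero d}} → ℕ → ℕ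
triangle d n = tri (n / d) d (n % d)

tri-suc-zero : ∀ q d → tri (suc q) d 0 ≡ tri q d d
tri-suc-zero zero          d = sym (n∸n≡0 d)
tri-suc-zero (suc zero)    d = refl
tri-suc-zero (suc (suc q)) d = tri-suc-zero q d

tri-double : ∀ q d r → tri q (2 * d) (2 * r) ≡ 2 * tri q d r
tri-double zero          d r = sym (*-distribˡ-∸ 2 d r)
tri-double (suc zero)    d r = refl
tri-double (suc (suc q)) d r = tri-double q d r

tri-suc-double : ∀ q {d r} → r < d → tri q (2 * d) (suc (2 * r)) ≡ tri q d r + tri q d (suc r)
tri-suc-double zero {d} {r} r<d = begin
  2 * d ∸ suc (2 * r)     ≡⟨ cong₂ _∸_ (2*m≡m+m d) (1+2*m≡m+[1+m] r) ⟩
  (d + d) ∸ (r + suc r)   ≡⟨ [m+n]∸[o+p]≡[m∸o]+[n∸p] (<⇒≤ r<d) r<d ⟩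
  (d ∸ r) + (d ∸ suc r)   ∎
  where open ≡-Reasoning
tri-suc-double (suc zero)    {r = r} _ = 1+2*m≡m+[1+m] r
tri-suc-double (suc (suc q)) r<d       = tri-suc-double q r<d

tri-even : ∀ m d r → tri (2 * m) d r ≡ d ∸ r
tri-even zero    d r = refl
tri-even (suc m) d r = trans (cong (λ q → tri q d r) (*-suc 2 m)) (tri-even m d r)

tri-odd : ∀ m d r → tri (suc (2 * m)) d r ≡ r
tri-odd zero    d r = refl
tri-odd (suc m) d r = trans (cong (λ q → tri (suc q) d r) (*-suc 2 m)) (tri-odd m d r)

[m+kn]/n≡k : ∀ m k n .{{_ : NonZero n}} → m < n → (m + k * n) / n ≡ k
[m+kn]/n≡k m k n m<n = begin
  (m + k * n) / n   ≡⟨ +-distrib-/-∣ʳ m (n∣m*n k) ⟩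
  m / n + k * n / n ≡⟨ cong₂ _+_ (m<n⇒m/n≡0 m<n) (m*n/n≡m k n) ⟩
  k                 ∎
  where open ≡-Reasoning

triangle-divMod< : ∀ d .{{_ : NonZero d}} q {r} → r < d → triangle d (r + q * d) ≡ tri q d r
triangle-divMod< d q {r} r<d = cong₂ (λ q′ r′ → tri q′ d r′) ([m+kn]/n≡k r q d r<d)
                                     (trans ([m+kn]%n≡m%n r q d) (m<n⇒m%n≡m r<d))

triangle-divMod : ∀ d .{{_ : NonZero d}} q {r} → r ≤ d → triangle d (r + q * d) ≡ tri q d r
triangle-divMod d q r≤d with m≤n⇒m<n∨m≡n r≤d
... | inj₁ r<d  = triangle-divMod< d q r<d
... | inj₂ refl = trans (triangle-divMod< d (suc q) (ℕ.>-nonZero⁻¹ d)) (tri-suc-zero q d)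

triangle-double : ∀ d .{{_ : NonZero d}} .{{_ : NonZero (2 * d)}} n →
  triangle (2 * d) (2 * n) ≡ 2 * triangle d n
triangle-double d n = begin
  triangle (2 * d) (2 * n)               ≡⟨ cong (λ x → triangle (2 * d) (2 * x)) (m≡m%n+[m/n]*n n d) ⟩
  triangle (2 * d) (2 * (r + q * d))     ≡⟨ cong (triangle (2 * d)) (double-divMod r q d) ⟩
  triangle (2 * d) (2 * r + q * (2 * d)) ≡⟨ triangle-divMod (2 * d) q (*-monoʳ-≤ 2 (m%n≤n n d)) ⟩
  tri q (2 * d) (2 * r)                  ≡⟨ tri-double q d r ⟩
  2 * triangle d n                       ∎
  where
  open ≡-Reasoning
  q = n / d
  r = n % d
  double-divMod : ∀ r q d → 2 * (r + q * d) ≡ 2 * r + q * (2 * d)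
  double-divMod = solve-∀

triangle-suc-double : ∀ d .{{_ : NonZero d}} .{{_ : NonZero (2 * d)}} n →
  triangle (2 * d) (suc (2 * n)) ≡ triangle d n + triangle d (suc n)
triangle-suc-double d n = begin
  triangle (2 * d) (suc (2 * n))               ≡⟨ cong (λ x → triangle (2 * d) (suc (2 * x))) n≡r+qd ⟩
  triangle (2 * d) (suc (2 * (r + q * d)))     ≡⟨ cong (triangle (2 * d)) (suc-double-divMod r q d) ⟩
  triangle (2 * d) (suc (2 * r) + q * (2 * d)) ≡⟨ triangle-divMod (2 * d) q (*-monoʳ-< 2 r<d) ⟩
  tri q (2 * d) (suc (2 * r))                  ≡⟨ tri-suc-double q r<d ⟩
  tri q d r + tri q d (suc r)                  ≡⟨ cong (λ x → triangle d n + x) (sym (triangle-divMod d q r<d)) ⟩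
  triangle d n + triangle d (suc r + q * d)    ≡⟨ cong (λ x → triangle d n + triangle d (suc x)) (sym n≡r+qd) ⟩
  triangle d n + triangle d (suc n)            ∎
  where
  open ≡-Reasoning
  q = n / d
  r = n % d
  r<d : r < d
  r<d = m%n<n n d
  n≡r+qd : n ≡ r + q * d
  n≡r+qd = m≡m%n+[m/n]*n n d
  suc-double-divMod : ∀ r q d → suc (2 * (r + q * d)) ≡ suc (2 * r) + q * (2 * d)
  suc-double-divMod = solve-∀

triangle-1 : ∀ n → triangle 1 n ≡ tri n 1 0
triangle-1 n = cong₂ (λ q r → tri q 1 r) (n/1≡n n) (n%1≡0 n)

triangle-self : ∀ d .{{_ : NonZero d}} → triangle d d ≡ 0
triangle-self d = begin
  triangle d d           ≡⟨ cong (triangle d) (sym (+-identityʳ d)) ⟩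
  triangle d (d + 0 * d) ≡⟨ triangle-divMod d 0 ≤-refl ⟩
  d ∸ d                  ≡⟨ n∸n≡0 d ⟩
  0                      ∎
  where open ≡-Reasoning

summand≡tri : ∀ q {d r} → r ≤ d →
  + ((q + 1) % 2) ℤ.* + d ℤ.+ ℤ.-1ℤ ℤ.^ ((q + 1) % 2) ℤ.* + r ≡ + tri q d r
summand≡tri zero {d} {r} r≤d = begin
  + 1 ℤ.* + d ℤ.+ ℤ.-1ℤ ℤ.* + r ≡⟨ cong₂ ℤ._+_ (ℤ.*-identityˡ (+ d)) (ℤ.-1*i≡-i (+ r)) ⟩
  + d ℤ.- + r                    ≡⟨ ℤ.m-n≡m⊖n d r ⟩
  d ℤ.⊖ r                        ≡⟨ ℤ.⊖-≥ r≤d ⟩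
  + (d ∸ r)                      ∎
  where open ≡-Reasoning
summand≡tri (suc zero)    {r = r} _   = trans (ℤ.+-identityˡ _) (ℤ.*-identityˡ (+ r))
summand≡tri (suc (suc q))         r≤d = summand≡tri q r≤d

term≡triangle : ∀ n i → let instance _ = m^n≢0 2 i in term n i ≡ + triangle (2 ^ i) n
term≡triangle n i = summand≡tri (n / 2 ^ i) (m%n≤n n (2 ^ i))
  where instance _ = m^n≢0 2 i

sumTo-cong : ∀ m {f g : ℕ → ℤ} → (∀ i → f i ≡ g i) → sumTo m f ≡ sumTo m g
sumTo-cong zero    f≗g = f≗g 0
sumTo-cong (suc m) f≗g = cong₂ ℤ._+_ (sumTo-cong m f≗g) (f≗g (suc m))

sumTo-suc : ∀ m (f : ℕ → ℤ) → sumTo (suc m) f ≡ f 0 ℤ.+ sumTo m (λ i → f (suc i))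
sumTo-suc zero    f = refl
sumTo-suc (suc m) f = trans (cong (ℤ._+ f (suc (suc m))) (sumTo-suc m f))
                            (ℤ.+-assoc (f 0) (sumTo m (λ i → f (suc i))) (f (suc (suc m))))

sumTo-+ : ∀ m (f g : ℕ → ℤ) → sumTo m (λ i → f i ℤ.+ g i) ≡ sumTo m f ℤ.+ sumTo m g
sumTo-+ zero    f g = refl
sumTo-+ (suc m) f g = trans (cong (ℤ._+ (f (suc m) ℤ.+ g (suc m))) (sumTo-+ m f g))
                            (interchange (sumTo m f) (sumTo m g) (f (suc m)) (g (suc m)))

term-even-0 : ∀ m → term (2 * m) 0 ≡ + 1
term-even-0 m = trans (term≡triangle (2 * m) 0) (cong +_ (trans (triangle-1 (2 * m)) (tri-even m 1 0)))

term-odd-0 : ∀ m → term (suc (2 * m)) 0 ≡ + 0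
term-odd-0 m = trans (term≡triangle (suc (2 * m)) 0) (cong +_ (trans (triangle-1 (suc (2 * m))) (tri-odd m 1 0)))

term-double : ∀ m i → term (2 * m) (suc i) ≡ term m i ℤ.+ term m i
term-double m i = begin
  term (2 * m) (suc i)              ≡⟨ term≡triangle (2 * m) (suc i) ⟩
  + triangle (2 ^ suc i) (2 * m)    ≡⟨ cong +_ (triangle-double d m) ⟩
  + (2 * triangle d m)              ≡⟨ cong +_ (2*m≡m+m (triangle d m)) ⟩
  + triangle d m ℤ.+ + triangle d m ≡⟨ sym (cong₂ ℤ._+_ (term≡triangle m i) (term≡triangle m i)) ⟩
  term m i ℤ.+ term m i             ∎
  where
  open ≡-Reasoning
  instance
    _ = m^n≢0 2 i
    _ = m^n≢0 2 (suc i)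
  d = 2 ^ i

term-suc-double : ∀ m i → term (suc (2 * m)) (suc i) ≡ term m i ℤ.+ term (suc m) i
term-suc-double m i = begin
  term (suc (2 * m)) (suc i)              ≡⟨ term≡triangle (suc (2 * m)) (suc i) ⟩
  + triangle (2 ^ suc i) (suc (2 * m))    ≡⟨ cong +_ (triangle-suc-double d m) ⟩
  + triangle d m ℤ.+ + triangle d (suc m) ≡⟨ sym (cong₂ ℤ._+_ (term≡triangle m i) (term≡triangle (suc m) i)) ⟩
  term m i ℤ.+ term (suc m) i             ∎
  where
  open ≡-Reasoning
  instance
    _ = m^n≢0 2 i
    _ = m^n≢0 2 (suc i)
  d = 2 ^ i

sumTo-⌊log₂⌋-term-suc : ∀ m .{{_ : NonZero m}} → sumTo ⌊log₂ m ⌋ (term (suc m)) ≡ formula (suc m)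
sumTo-⌊log₂⌋-term-suc m with m≤n⇒m<n∨m≡n (⌊log₂⌋-mono-≤ (n≤1+n m))
... | inj₂ L≡K = cong (λ k → sumTo k (term (suc m))) L≡K
... | inj₁ L<K = begin
  sumTo L (term (suc m))         ≡⟨ sym (ℤ.+-identityʳ _) ⟩
  sumTo L (term (suc m)) ℤ.+ + 0 ≡⟨ cong (λ x → sumTo L (term (suc m)) ℤ.+ x) (sym last-term≡0) ⟩
  sumTo (suc L) (term (suc m))   ≡⟨ cong (λ k → sumTo k (term (suc m))) (sym K≡1+L) ⟩
  formula (suc m)                ∎
  where
  open ≡-Reasoning
  L = ⌊log₂ m ⌋
  K≡1+L : ⌊log₂ suc m ⌋ ≡ suc L
  K≡1+L = ≤-antisym
    (≤-trans (⌊log₂⌋-mono-≤ (s≤s (m≤m+n m _))) (≤-reflexive (⌊log₂[1+2*n]⌋≡1+⌊log₂n⌋ m)))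
    L<K
  instance _ = m^n≢0 2 (suc L)
  last-term≡0 : term (suc m) (suc L) ≡ + 0
  last-term≡0 = begin
    term (suc m) (suc L)               ≡⟨ term≡triangle (suc m) (suc L) ⟩
    + triangle (2 ^ suc L) (suc m)     ≡⟨ cong (λ n → + triangle (2 ^ suc L) n) suc-m≡2^[1+L] ⟩
    + triangle (2 ^ suc L) (2 ^ suc L) ≡⟨ cong +_ (triangle-self (2 ^ suc L)) ⟩
    + 0                                ∎
    where
    suc-m≡2^[1+L] : suc m ≡ 2 ^ suc L
    suc-m≡2^[1+L] = trans (⌊log₂⌋-jump m L<K) (cong (2 ^_) K≡1+L)

formula-double : ∀ m .{{_ : NonZero m}} → formula (2 * m) ≡ + 1 ℤ.+ (formula m ℤ.+ formula m)
formula-double m = begin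
  sumTo ⌊log₂ 2 * m ⌋ (term (2 * m))
    ≡⟨ cong (λ k → sumTo k (term (2 * m))) (⌊log₂[2*b]⌋≡1+⌊log₂b⌋ m) ⟩
  sumTo (suc L) (term (2 * m))
    ≡⟨ sumTo-suc L (term (2 * m)) ⟩
  term (2 * m) 0 ℤ.+ sumTo L (λ i → term (2 * m) (suc i))
    ≡⟨ cong₂ ℤ._+_ (term-even-0 m) (sumTo-cong L (term-double m)) ⟩
  + 1 ℤ.+ sumTo L (λ i → term m i ℤ.+ term m i)
    ≡⟨ cong (λ x → + 1 ℤ.+ x) (sumTo-+ L (term m) (term m)) ⟩
  + 1 ℤ.+ (formula m ℤ.+ formula m)
    ∎
  where
  open ≡-Reasoning
  L = ⌊log₂ m ⌋

formula-suc-double : ∀ m .{{_ : NonZero m}} → formula (suc (2 * m)) ≡ formula m ℤ.+ formula (suc m)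
formula-suc-double m = begin
  sumTo ⌊log₂ suc (2 * m) ⌋ (term (suc (2 * m)))
    ≡⟨ cong (λ k → sumTo k (term (suc (2 * m)))) (⌊log₂[1+2*n]⌋≡1+⌊log₂n⌋ m) ⟩
  sumTo (suc L) (term (suc (2 * m)))
    ≡⟨ sumTo-suc L (term (suc (2 * m))) ⟩
  term (suc (2 * m)) 0 ℤ.+ sumTo L (λ i → term (suc (2 * m)) (suc i))
    ≡⟨ cong₂ ℤ._+_ (term-odd-0 m) (sumTo-cong L (term-suc-double m)) ⟩
  + 0 ℤ.+ sumTo L (λ i → term m i ℤ.+ term (suc m) i)
    ≡⟨ ℤ.+-identityˡ _ ⟩
  sumTo L (λ i → term m i ℤ.+ term (suc m) i)
    ≡⟨ sumTo-+ L (term m) (term (suc m)) ⟩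
  formula m ℤ.+ sumTo L (term (suc m))
    ≡⟨ cong (λ x → formula m ℤ.+ x) (sumTo-⌊log₂⌋-term-suc m) ⟩
  formula m ℤ.+ formula (suc m)
    ∎
  where
  open ≡-Reasoning
  L = ⌊log₂ m ⌋

sIndicator : ℕ → ℕ → ℕ
sIndicator a b = if does (a ≟ b) then 1 else 0

sIndicator-comm : ∀ a b → sIndicator a b ≡ sIndicator b a
sIndicator-comm zero    zero    = refl
sIndicator-comm zero    (suc b) = refl
sIndicator-comm (suc a) zero    = refl
sIndicator-comm (suc a) (suc b) = sIndicator-comm a b

halves⇒balanced : ∀ a b → a ≡ ⌊ a + b /2⌋ → b ≡ a ⊎ b ≡ suc a
halves⇒balanced a b a≡⌊n/2⌋ with n≡2*⌊n/2⌋⊎n≡1+2*⌊n/2⌋ (a + b)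
... | inj₁ n≡2h   = inj₁ (+-cancelˡ-≡ a b a (begin
  a + b             ≡⟨ n≡2h ⟩
  2 * ⌊ a + b /2⌋   ≡⟨ cong (2 *_) (sym a≡⌊n/2⌋) ⟩
  2 * a             ≡⟨ 2*m≡m+m a ⟩
  a + a             ∎))
  where open ≡-Reasoning
... | inj₂ n≡1+2h = inj₂ (+-cancelˡ-≡ a b (suc a) (begin
  a + b                 ≡⟨ n≡1+2h ⟩
  suc (2 * ⌊ a + b /2⌋) ≡⟨ cong (λ h → suc (2 * h)) (sym a≡⌊n/2⌋) ⟩
  suc (2 * a)           ≡⟨ 1+2*m≡m+[1+m] a ⟩
  a + suc a             ∎))
  where open ≡-Reasoning

formula-balanced : ∀ a b .{{_ : NonZero a}} → b ≡ a ⊎ b ≡ suc a →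
  formula (a + b) ≡ + sIndicator a b ℤ.+ (formula a ℤ.+ formula b)
formula-balanced a .a (inj₁ refl) rewrite dec-true (a ≟ a) refl =
  trans (cong formula (sym (2*m≡m+m a))) (formula-double a)
formula-balanced a .(suc a) (inj₂ refl) rewrite dec-false (a ≟ suc a) (1+n≢n ∘ sym) =
  trans (cong formula (sym (1+2*m≡m+[1+m] a))) (trans (formula-suc-double a) (sym (ℤ.+-identityˡ _)))

formula-node : ∀ {a b} .{{_ : NonZero a}} .{{_ : NonZero b}} →
  (a ≡ ⌊ a + b /2⌋ × b ≡ ⌈ a + b /2⌉) ⊎ (a ≡ ⌈ a + b /2⌉ × b ≡ ⌊ a + b /2⌋) →
  formula (a + b) ≡ + sIndicator a b ℤ.+ (formula a ℤ.+ formula b)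
formula-node {a} {b} (inj₁ (a≡⌊n/2⌋ , _)) = formula-balanced a b (halves⇒balanced a b a≡⌊n/2⌋)
formula-node {a} {b} (inj₂ (_ , b≡⌊n/2⌋)) = begin
  formula (a + b)                                  ≡⟨ cong formula (+-comm a b) ⟩
  formula (b + a)                                  ≡⟨ formula-balanced b a (halves⇒balanced b a b≡⌊n′/2⌋) ⟩
  + sIndicator b a ℤ.+ (formula b ℤ.+ formula a)   ≡⟨ cong₂ (λ s f → + s ℤ.+ f) (sIndicator-comm b a)
                                                                   (ℤ.+-comm (formula b) (formula a)) ⟩
  + sIndicator a b ℤ.+ (formula a ℤ.+ formula b)   ∎
  where
  open ≡-Reasoning
  b≡⌊n′/2⌋ : b ≡ ⌊ b + a /2⌋
  b≡⌊n′/2⌋ = trans b≡⌊n/2⌋ (cong ⌊_/2⌋ (+-comm a b))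

0<leaves : ∀ t → 0 < leaves t
0<leaves leaf       = s≤s z≤n
0<leaves (node l r) = ≤-trans (0<leaves l) (m≤m+n (leaves l) (leaves r))

sNodes≡formula : ∀ {t} → Pairwise t → + sNodes t ≡ formula (leaves t)
sNodes≡formula leaf                        = refl
sNodes≡formula (node {l} {r} pl pr halves) = begin
  + sIndicator a b ℤ.+ (+ sNodes l ℤ.+ + sNodes r)  ≡⟨ cong₂ (λ x y → + sIndicator a b ℤ.+ (x ℤ.+ y))
                                                           (sNodes≡formula pl) (sNodes≡formula pr) ⟩
  + sIndicator a b ℤ.+ (formula a ℤ.+ formula b)    ≡⟨ sym (formula-node halves) ⟩
  formula (a + b)                                   ∎
  where
  open ≡-Reasoning
  a = leaves l
  b = leaves r
  instance
    _ = ℕ.>-nonZero (0<leaves l)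
    _ = ℕ.>-nonZero (0<leaves r)

proposition13 : (n : ℕ) → n ≥ 1 → (t : Tree) → Pairwise t → leaves t ≡ n →
    + sNodes t ≡ formula n
proposition13 _ _ _ pairwise refl = sNodes≡formula pairwise
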